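{- Let $k$ be a positive integer. For every integer $n\ge0$, $$\sum_{m=0}^n B_{km}B_{k(n-m)}=B_k\sum_{l=1}^{\lfloor (n+1)/2\rfloor}(n-2l+1)B_{k(n-2l+1)}.$$
   Context: The balancing numbers are defined by $B_0=0$, $B_1=1$, $B_n=6B_{n-1}-B_{n-2}$ for $n\ge 2$. $\lfloor x\rfloor$ denotes the integer part of $x$. -}

module Defs where

open import Data.Nat using (ℕ; zero; suc; _∸_; _*_; _/_)
open import Data.Integer using (ℤ; +_; _+_; _-_) renaming (_*_ to _*ℤ_)

B : ℕ → ℤ
B zero = + 0
B (suc zero) = + 1
B (suc (suc n)) = (+ 6) *ℤ B (suc n) - B n

-- Σ[ i = lo .. hi ] f i  (inclusive; empty when hi < lo), as sum over i = lo + j, j < hi + 1 - lo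
sumFrom : ℕ → ℕ → (ℕ → ℤ) → ℤ
sumFrom lo zero f = + 0
sumFrom lo (suc c) f = f lo + sumFrom (suc lo) c f

sumRange : ℕ → ℕ → (ℕ → ℤ) → ℤ
sumRange lo hi f = sumFrom lo (suc hi ∸ lo) f

{-# OPTIONS --safe #-}
-- The sequence a m = B (k m) satisfies the product rule
--   a (p+1) a (q+1) = a p a q + B k · a (p+q+1),
-- an instance of B (y+k) B (x+k) − B y B x = B k B (x+y+k), which holds because both
-- sides satisfy the balancing recurrence in x and agree at x = 0, 1 (by Cassini's
-- identity). Only a 0 = 0 and the product rule matter: applied termwise to the
-- convolution S (n+2) they give S (n+2) = S n + (n+1) B k a (n+1), and the right-hand
-- side obeys the same two-step recurrence because ⌊(n+3)/2⌋ = ⌊(n+1)/2⌋ + 1.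
module Submission where

open import Defs
open import Data.Nat using (ℕ; suc; _∸_; _/_; NonZero)
open import Data.Integer using (ℤ; +_; _+_) renaming (_*_ to _*ℤ_)
open import Relation.Binary.PropositionalEquality using (_≡_)
import Data.Nat as N

open import Data.Nat using (zero; z≤n; s≤s) renaming (_<_ to _<ℕ_; _≤_ to _≤ℕ_)
import Data.Nat.Properties as NP
import Data.Nat.DivMod as DM
import Data.Nat.Tactic.RingSolver as NatSolver
open import Data.Integer using (_-_)
import Data.Integer.Properties as ZP
open import Data.Integer.Tactic.RingSolver using (solve-∀)
open import Relation.Binary.PropositionalEquality
  using (refl; sym; trans; cong; cong₂; subst; module ≡-Reasoning)
open ≡-Reasoning

-- A record rather than a Π-type, so that f can be inferred from a proof of Recurrent f.
record Recurrent (f : ℕ → ℤ) : Set where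
  constructor recurrent
  field step : ∀ x → f (suc (suc x)) ≡ + 6 *ℤ f (suc x) - f x
open Recurrent

B-recurrent : Recurrent B
B-recurrent = recurrent λ x → refl

B-shift-recurrent : ∀ c → Recurrent (λ x → B (x N.+ c))
B-shift-recurrent c = recurrent λ x → refl

recurrent-* : ∀ s {f} → Recurrent f → Recurrent (λ x → s *ℤ f x)
recurrent-* s {f} rf = recurrent λ x →
  trans (cong (s *ℤ_) (step rf x)) (distrib s (f (suc x)) (f x))
  where
  distrib : ∀ s u v → s *ℤ (+ 6 *ℤ u - v) ≡ + 6 *ℤ (s *ℤ u) - s *ℤ v
  distrib = solve-∀

recurrent-- : ∀ {f g} → Recurrent f → Recurrent g → Recurrent (λ x → f x - g x)
recurrent-- {f} {g} rf rg = recurrent λ x →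
  trans (cong₂ _-_ (step rf x) (step rg x)) (distrib (f (suc x)) (f x) (g (suc x)) (g x))
  where
  distrib : ∀ u v u′ v′ →
            (+ 6 *ℤ u - v) - (+ 6 *ℤ u′ - v′) ≡ + 6 *ℤ (u - u′) - (v - v′)
  distrib = solve-∀

recurrent-unique : ∀ {f g} → Recurrent f → Recurrent g →
                   f 0 ≡ g 0 → f 1 ≡ g 1 → ∀ x → f x ≡ g x
recurrent-unique rf rg f0≡g0 f1≡g1 zero = f0≡g0
recurrent-unique rf rg f0≡g0 f1≡g1 (suc zero) = f1≡g1
recurrent-unique {f} {g} rf rg f0≡g0 f1≡g1 (suc (suc x)) = begin
  f (suc (suc x))        ≡⟨ step rf x ⟩
  + 6 *ℤ f (suc x) - f x ≡⟨ cong₂ (λ u v → + 6 *ℤ u - v) (f≡g (suc x)) (f≡g x) ⟩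
  + 6 *ℤ g (suc x) - g x ≡⟨ sym (step rg x) ⟩
  g (suc (suc x))        ∎
  where
  f≡g : ∀ x → f x ≡ g x
  f≡g = recurrent-unique rf rg f0≡g0 f1≡g1

B-cassini : ∀ k → B (suc k) *ℤ B (suc k) - B k *ℤ B (suc (suc k)) ≡ + 1
B-cassini zero = refl
B-cassini (suc k) = trans (cassini-step (B k) (B (suc k))) (B-cassini k)
  where
  cassini-step : ∀ a b →
    (+ 6 *ℤ b - a) *ℤ (+ 6 *ℤ b - a) - b *ℤ (+ 6 *ℤ (+ 6 *ℤ b - a) - b)
      ≡ b *ℤ b - a *ℤ (+ 6 *ℤ b - a)
  cassini-step = solve-∀

B[k+1]B[y+k]-B[k]B[y+k+1]≡B[y] : ∀ k y →
  B (suc k) *ℤ B (y N.+ k) - B k *ℤ B (y N.+ suc k) ≡ B y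
B[k+1]B[y+k]-B[k]B[y+k+1]≡B[y] k =
  recurrent-unique
    (recurrent-- (recurrent-* (B (suc k)) (B-shift-recurrent k))
                 (recurrent-* (B k) (B-shift-recurrent (suc k))))
    B-recurrent (commute (B (suc k)) (B k)) (B-cassini k)
  where
  commute : ∀ a b → a *ℤ b - b *ℤ a ≡ + 0
  commute = solve-∀

B[y+k]B[x+k]-B[y]B[x]≡B[k]B[x+y+k] : ∀ k y x →
  B (y N.+ k) *ℤ B (x N.+ k) - B y *ℤ B x ≡ B k *ℤ B (x N.+ (y N.+ k))
B[y+k]B[x+k]-B[y]B[x]≡B[k]B[x+y+k] k y =
  recurrent-unique
    (recurrent-- (recurrent-* (B (y N.+ k)) (B-shift-recurrent k))
                 (recurrent-* (B y) B-recurrent))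
    (recurrent-* (B k) (B-shift-recurrent (y N.+ k)))
    (at-zero (B (y N.+ k)) (B k) (B y))
    (begin
      B (y N.+ k) *ℤ B (suc k) - B y *ℤ + 1
        ≡⟨ cong (λ t → B (y N.+ k) *ℤ B (suc k) - t *ℤ + 1)
                (sym (B[k+1]B[y+k]-B[k]B[y+k+1]≡B[y] k y)) ⟩
      B (y N.+ k) *ℤ B (suc k) - (B (suc k) *ℤ B (y N.+ k) - B k *ℤ B (y N.+ suc k)) *ℤ + 1
        ≡⟨ at-one (B (y N.+ k)) (B (suc k)) (B k) (B (y N.+ suc k)) ⟩
      B k *ℤ B (y N.+ suc k)
        ≡⟨ cong (λ t → B k *ℤ B t) (NP.+-suc y k) ⟩
      B k *ℤ B (suc (y N.+ k)) ∎)
  where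
  at-zero : ∀ a b c → a *ℤ b - c *ℤ + 0 ≡ b *ℤ a
  at-zero = solve-∀
  at-one : ∀ a b d e → a *ℤ b - (b *ℤ a - d *ℤ e) *ℤ + 1 ≡ d *ℤ e
  at-one = solve-∀

sumFrom-shift : ∀ lo c f → sumFrom (suc lo) c f ≡ sumFrom lo c (λ j → f (suc j))
sumFrom-shift lo zero f = refl
sumFrom-shift lo (suc c) f = cong (_+_ (f (suc lo))) (sumFrom-shift (suc lo) c f)

sumFrom-snoc : ∀ lo c f → sumFrom lo (suc c) f ≡ sumFrom lo c f + f (lo N.+ c)
sumFrom-snoc lo zero f = begin
  f lo + + 0         ≡⟨ ZP.+-identityʳ (f lo) ⟩
  f lo               ≡⟨ cong f (sym (NP.+-identityʳ lo)) ⟩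
  f (lo N.+ 0)       ≡⟨ sym (ZP.+-identityˡ (f (lo N.+ 0))) ⟩
  + 0 + f (lo N.+ 0) ∎
sumFrom-snoc lo (suc c) f = begin
  f lo + sumFrom (suc lo) (suc c) f
    ≡⟨ cong (_+_ (f lo)) (sumFrom-snoc (suc lo) c f) ⟩
  f lo + (sumFrom (suc lo) c f + f (suc lo N.+ c))
    ≡⟨ sym (ZP.+-assoc (f lo) _ _) ⟩
  f lo + sumFrom (suc lo) c f + f (suc lo N.+ c)
    ≡⟨ cong (λ i → f lo + sumFrom (suc lo) c f + f i) (sym (NP.+-suc lo c)) ⟩
  f lo + sumFrom (suc lo) c f + f (lo N.+ suc c) ∎

sumFrom-cong : ∀ lo c {f g} → (∀ j → lo ≤ℕ j → j <ℕ lo N.+ c → f j ≡ g j) →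
               sumFrom lo c f ≡ sumFrom lo c g
sumFrom-cong lo zero f≗g = refl
sumFrom-cong lo (suc c) f≗g =
  cong₂ _+_ (f≗g lo NP.≤-refl (NP.m<m+n lo (s≤s z≤n)))
            (sumFrom-cong (suc lo) c λ j lo<j j<1+lo+c →
               f≗g j (NP.<⇒≤ lo<j) (subst (j <ℕ_) (sym (NP.+-suc lo c)) j<1+lo+c))

sumFrom-+ : ∀ lo c f g → sumFrom lo c (λ j → f j + g j) ≡ sumFrom lo c f + sumFrom lo c g
sumFrom-+ lo zero f g = refl
sumFrom-+ lo (suc c) f g =
  trans (cong (_+_ (f lo + g lo)) (sumFrom-+ (suc lo) c f g)) (interchange (f lo) (g lo) _ _)
  where
  interchange : ∀ a b s t → (a + b) + (s + t) ≡ (a + s) + (b + t)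
  interchange = solve-∀

sumFrom-const : ∀ lo c v → sumFrom lo c (λ _ → v) ≡ + c *ℤ v
sumFrom-const lo zero v = sym (ZP.*-zeroˡ v)
sumFrom-const lo (suc c) v = begin
  v + sumFrom (suc lo) c (λ _ → v) ≡⟨ cong (_+_ v) (sumFrom-const (suc lo) c v) ⟩
  v + + c *ℤ v                     ≡⟨ cong (_+ + c *ℤ v) (sym (ZP.*-identityˡ v)) ⟩
  + 1 *ℤ v + + c *ℤ v              ≡⟨ sym (ZP.*-distribʳ-+ v (+ 1) (+ c)) ⟩
  + suc c *ℤ v                     ∎

module ProductRule (a : ℕ → ℤ) (c : ℤ) (a-zero : a 0 ≡ + 0)
  (a-suc-*-a-suc : ∀ p q → a (suc p) *ℤ a (suc q) ≡ a p *ℤ a q + c *ℤ a (suc (p N.+ q)))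
  where

  convolution : ℕ → ℤ
  convolution n = sumFrom 0 (suc n) (λ m → a m *ℤ a (n ∸ m))

  oddTerm : ℕ → ℕ → ℤ
  oddTerm n l = + (suc n ∸ 2 N.* l) *ℤ a (suc n ∸ 2 N.* l)

  oddSum : ℕ → ℤ
  oddSum n = sumFrom 1 (suc n / 2) (oddTerm n)

  a-zero-* : ∀ x → a 0 *ℤ x ≡ + 0
  a-zero-* x = trans (cong (_*ℤ x) a-zero) (ZP.*-zeroˡ x)

  *-a-zero : ∀ x → x *ℤ a 0 ≡ + 0
  *-a-zero x = trans (cong (x *ℤ_) a-zero) (ZP.*-zeroʳ x)

  convolution-suc : ∀ n →
    convolution (suc n) ≡ sumFrom 0 (suc n) (λ j → a (suc j) *ℤ a (n ∸ j))
  convolution-suc n = begin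
    a 0 *ℤ a (suc n) + sumFrom 1 (suc n) F ≡⟨ cong (_+ sumFrom 1 (suc n) F) (a-zero-* _) ⟩
    + 0 + sumFrom 1 (suc n) F              ≡⟨ ZP.+-identityˡ _ ⟩
    sumFrom 1 (suc n) F                    ≡⟨ sumFrom-shift 0 (suc n) F ⟩
    sumFrom 0 (suc n) (λ j → F (suc j))    ∎
    where
    F : ℕ → ℤ
    F m = a m *ℤ a (suc n ∸ m)

  convolution-term : ∀ n j → j <ℕ suc n →
    a (suc j) *ℤ a (suc n ∸ j) ≡ a j *ℤ a (n ∸ j) + c *ℤ a (suc n)
  convolution-term n j (s≤s j≤n) = begin
    a (suc j) *ℤ a (suc n ∸ j)
      ≡⟨ cong (λ i → a (suc j) *ℤ a i) (NP.+-∸-assoc 1 j≤n) ⟩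
    a (suc j) *ℤ a (suc (n ∸ j))
      ≡⟨ a-suc-*-a-suc j (n ∸ j) ⟩
    a j *ℤ a (n ∸ j) + c *ℤ a (suc (j N.+ (n ∸ j)))
      ≡⟨ cong (λ i → a j *ℤ a (n ∸ j) + c *ℤ a (suc i)) (NP.m+[n∸m]≡n j≤n) ⟩
    a j *ℤ a (n ∸ j) + c *ℤ a (suc n) ∎

  convolution-suc-suc : ∀ n →
    convolution (suc (suc n)) ≡ convolution n + + suc n *ℤ (c *ℤ a (suc n))
  convolution-suc-suc n = begin
    convolution (suc (suc n))
      ≡⟨ convolution-suc (suc n) ⟩
    sumFrom 0 (suc (suc n)) G
      ≡⟨ sumFrom-snoc 0 (suc n) G ⟩
    sumFrom 0 (suc n) G + G (suc n)
      ≡⟨ cong (_+_ (sumFrom 0 (suc n) G)) G-last ⟩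
    sumFrom 0 (suc n) G + + 0
      ≡⟨ ZP.+-identityʳ _ ⟩
    sumFrom 0 (suc n) G
      ≡⟨ sumFrom-cong 0 (suc n) (λ j _ → convolution-term n j) ⟩
    sumFrom 0 (suc n) (λ j → H j + C)
      ≡⟨ sumFrom-+ 0 (suc n) H (λ _ → C) ⟩
    convolution n + sumFrom 0 (suc n) (λ _ → C)
      ≡⟨ cong (_+_ (convolution n)) (sumFrom-const 0 (suc n) C) ⟩
    convolution n + + suc n *ℤ C ∎
    where
    G H : ℕ → ℤ
    G j = a (suc j) *ℤ a (suc n ∸ j)
    H j = a j *ℤ a (n ∸ j)
    C : ℤ
    C = c *ℤ a (suc n)
    G-last : G (suc n) ≡ + 0
    G-last = trans (cong (λ i → a (suc (suc n)) *ℤ a i) (NP.n∸n≡0 n))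
                   (*-a-zero (a (suc (suc n))))

  oddSum-suc-suc : ∀ n → oddSum (suc (suc n)) ≡ + suc n *ℤ a (suc n) + oddSum n
  oddSum-suc-suc n = begin
    sumFrom 1 (suc (suc (suc n)) / 2) T
      ≡⟨ cong (λ t → sumFrom 1 t T) [n+3]/2≡1+[n+1]/2 ⟩
    T 1 + sumFrom 2 (suc n / 2) T
      ≡⟨ cong (_+_ (T 1)) (sumFrom-shift 1 (suc n / 2) T) ⟩
    T 1 + sumFrom 1 (suc n / 2) (λ l → T (suc l))
      ≡⟨ cong (_+_ (T 1)) (sumFrom-cong 1 (suc n / 2) λ l _ _ → oddTerm-suc-suc l) ⟩
    + suc n *ℤ a (suc n) + oddSum n ∎
    where
    T : ℕ → ℤ
    T = oddTerm (suc (suc n))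
    [n+3]/2≡1+[n+1]/2 : suc (suc (suc n)) / 2 ≡ suc (suc n / 2)
    [n+3]/2≡1+[n+1]/2 = DM.m/n≡1+[m∸n]/n {suc (suc (suc n))} {2} (s≤s (s≤s z≤n))
    oddTerm-suc-suc : ∀ l → T (suc l) ≡ oddTerm n l
    oddTerm-suc-suc l =
      cong (λ i → + (suc (suc (suc n)) ∸ i) *ℤ a (suc (suc (suc n)) ∸ i)) (NP.*-suc 2 l)

  convolution≡c*oddSum : ∀ n → convolution n ≡ c *ℤ oddSum n
  convolution≡c*oddSum zero rewrite a-zero = sym (ZP.*-zeroʳ c)
  convolution≡c*oddSum (suc zero) rewrite a-zero | ZP.*-zeroʳ (a 1) = sym (ZP.*-zeroʳ c)
  convolution≡c*oddSum (suc (suc n)) = begin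
    convolution (suc (suc n))           ≡⟨ convolution-suc-suc n ⟩
    convolution n + + suc n *ℤ (c *ℤ x) ≡⟨ cong (_+ + suc n *ℤ (c *ℤ x)) IH ⟩
    c *ℤ oddSum n + + suc n *ℤ (c *ℤ x) ≡⟨ factor-c c (oddSum n) (+ suc n) x ⟩
    c *ℤ (+ suc n *ℤ x + oddSum n)      ≡⟨ cong (c *ℤ_) (sym (oddSum-suc-suc n)) ⟩
    c *ℤ oddSum (suc (suc n))           ∎
    where
    x : ℤ
    x = a (suc n)
    IH : convolution n ≡ c *ℤ oddSum n
    IH = convolution≡c*oddSum n
    factor-c : ∀ c s m x → c *ℤ s + m *ℤ (c *ℤ x) ≡ c *ℤ (m *ℤ x + s)
    factor-c = solve-∀

B[k*]-product-rule : ∀ k p q →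
  B (k N.* suc p) *ℤ B (k N.* suc q)
    ≡ B (k N.* p) *ℤ B (k N.* q) + B k *ℤ B (k N.* suc (p N.+ q))
B[k*]-product-rule k p q = begin
  B (k N.* suc p) *ℤ B (k N.* suc q)
    ≡⟨ cong₂ (λ i j → B i *ℤ B j) (k*[1+m]≡k*m+k p) (k*[1+m]≡k*m+k q) ⟩
  B (k N.* p N.+ k) *ℤ B (k N.* q N.+ k)
    ≡⟨ x-y≡z⇒x≡y+z (B[y+k]B[x+k]-B[y]B[x]≡B[k]B[x+y+k] k (k N.* p) (k N.* q)) ⟩
  B (k N.* p) *ℤ B (k N.* q) + B k *ℤ B (k N.* q N.+ (k N.* p N.+ k))
    ≡⟨ cong (λ i → B (k N.* p) *ℤ B (k N.* q) + B k *ℤ B i)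
            (k*q+[k*p+k]≡k*[1+p+q] k p q) ⟩
  B (k N.* p) *ℤ B (k N.* q) + B k *ℤ B (k N.* suc (p N.+ q)) ∎
  where
  k*[1+m]≡k*m+k : ∀ m → k N.* suc m ≡ k N.* m N.+ k
  k*[1+m]≡k*m+k m = trans (NP.*-suc k m) (NP.+-comm k (k N.* m))
  k*q+[k*p+k]≡k*[1+p+q] : ∀ k p q → k N.* q N.+ (k N.* p N.+ k) ≡ k N.* suc (p N.+ q)
  k*q+[k*p+k]≡k*[1+p+q] = NatSolver.solve-∀
  x-y≡z⇒x≡y+z : ∀ {x y z} → x - y ≡ z → x ≡ y + z
  x-y≡z⇒x≡y+z {x} {y} refl = x≡y+[x-y] x y
    where
    x≡y+[x-y] : ∀ x y → x ≡ y + (x - y)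
    x≡y+[x-y] = solve-∀

corollary1 : (k : ℕ) → .{{_ : NonZero k}} → (n : ℕ) →
    sumRange 0 n (λ m → B (k N.* m) *ℤ B (k N.* (n ∸ m)))
      ≡ B k *ℤ sumRange 1 (suc n / 2)
          (λ l → (+ (suc n ∸ 2 N.* l)) *ℤ B (k N.* (suc n ∸ 2 N.* l)))
-- The identity holds for k = 0 as well.
corollary1 k = ProductRule.convolution≡c*oddSum (λ m → B (k N.* m)) (B k)
                 (cong B (NP.*-zeroʳ k)) (B[k*]-product-rule k)
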